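{- Let $G$ be a graph and $S\subseteq V(G)$ a set of vertices which is contained in at least $\ell$ cliques of size $r$, where $r>|S|$. Then there are at least $\ell^{1/(r-|S|)}$ vertices of $G$ adjacent to every vertex of $S$. -}

module Defs where

open import Level using (0ℓ)
open import Data.Nat using (ℕ)
open import Data.Fin using (Fin)
open import Data.Fin.Subset using (Subset; _∈_; _⊆_; ∣_∣)
open import Data.Fin.Subset.Properties using (_∈?_)
open import Data.Fin.Properties using (all?)
open import Data.Vec using (tabulate)
open import Data.Product using (_×_)
open import Relation.Nullary using (Dec; ¬_; does)
open import Relation.Nullary.Decidable using (_→-dec_)
open import Relation.Binary.PropositionalEquality using (_≡_; _≢_)
open import Function.Definitions using (Injective)

record Graph (n : ℕ) : Set₁ where
  field
    Adj    : Fin n → Fin n → Set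
    adj?   : ∀ u v → Dec (Adj u v)
    sym    : ∀ {u v} → Adj u v → Adj v u
    irrefl : ∀ {u} → ¬ Adj u u

open Graph public

module _ {n : ℕ} (G : Graph n) where

  IsClique : Subset n → Set
  IsClique K = ∀ {u v} → u ∈ K → v ∈ K → u ≢ v → Adj G u v

  IsRCliqueContaining : ℕ → Subset n → Subset n → Set
  IsRCliqueContaining r S K = IsClique K × ∣ K ∣ ≡ r × S ⊆ K

  AtLeastCliquesContaining : ℕ → ℕ → Subset n → Set
  AtLeastCliquesContaining ℓ r S =
    Data.Product.Σ (Fin ℓ → Subset n) λ f →
      Injective _≡_ _≡_ f × (∀ i → IsRCliqueContaining r S (f i))

  IsCommonNbr : Subset n → Fin n → Set
  IsCommonNbr S v = ∀ s → s ∈ S → Adj G s v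

  isCommonNbr? : ∀ S v → Dec (IsCommonNbr S v)
  isCommonNbr? S v = all? (λ s → (s ∈? S) →-dec adj? G s v)

  CommonNbhd : Subset n → Subset n
  CommonNbhd S = tabulate (λ v → does (isCommonNbr? S v))

-- Sending each r-clique K ⊇ S to K ─ S is injective, and K ─ S is a
-- (r − |S|)-subset of the common neighbourhood N of S, since every vertex
-- of K outside S is adjacent to all of S. There are at most |N|^(r−|S|)
-- such subsets, which gives ℓ ≤ |N|^(r−|S|).
module Submission where

open import Defs hiding (sym)
open import Data.Nat using (ℕ; zero; suc; pred; _+_; _^_; _∸_; _≤_; _<_; z≤n; s≤s)
open import Data.Nat.Properties
  using (module ≤-Reasoning; ≤-trans; n≤1+n; +-mono-≤; *-monoʳ-≤; ^-monoˡ-≤; +-suc; m+n∸m≡n)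
open import Data.Fin using (Fin)
open import Data.Fin.Properties using (injective⇒≤)
open import Data.Fin.Subset using (Subset; _∈_; _∉_; _⊆_; _∪_; _─_; ∣_∣; inside; outside)
open import Data.Fin.Subset.Properties using (drop-∷-⊆; p─q⊆p)
open import Data.Vec using ([]; _∷_; here; there)
open import Data.Vec.Properties using (lookup∘tabulate; lookup⇒[]=)
open import Data.List using (List; length; map; _++_; lookup) renaming ([] to []ₗ; _∷_ to _∷ₗ_)
open import Data.List.Properties using (length-map; length-++)
import Data.List.Membership.Propositional as List
open import Data.List.Membership.Propositional.Properties using (∈-map⁺; ∈-++⁺ˡ; ∈-++⁺ʳ)
import Data.List.Relation.Unary.Any as Any
open import Data.List.Relation.Unary.Any.Properties using (lookup-index)
open import Data.Product using (_,_; proj₁; proj₂)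
open import Function.Definitions using (Injective)
open import Relation.Nullary using (contradiction)
open import Relation.Nullary.Decidable using (dec-true)
open import Relation.Binary.PropositionalEquality
  using (_≡_; refl; sym; trans; cong; cong₂; subst; module ≡-Reasoning)

private variable
  n : ℕ

x∈p─q⇒x∉q : ∀ (p q : Subset n) {x} → x ∈ p ─ q → x ∉ q
x∈p─q⇒x∉q (_ ∷ p) (outside ∷ q) (there x∈p─q) (there x∈q) = x∈p─q⇒x∉q p q x∈p─q x∈q
x∈p─q⇒x∉q (_ ∷ p) (inside  ∷ q) (there x∈p─q) (there x∈q) = x∈p─q⇒x∉q p q x∈p─q x∈q

q⊆p⇒q∪[p─q]≡p : ∀ (p q : Subset n) → q ⊆ p → q ∪ (p ─ q) ≡ p
q⊆p⇒q∪[p─q]≡p []            []            _   = refl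
q⊆p⇒q∪[p─q]≡p (x       ∷ p) (outside ∷ q) q⊆p = cong (x ∷_) (q⊆p⇒q∪[p─q]≡p p q (drop-∷-⊆ q⊆p))
q⊆p⇒q∪[p─q]≡p (inside  ∷ p) (inside  ∷ q) q⊆p = cong (inside ∷_) (q⊆p⇒q∪[p─q]≡p p q (drop-∷-⊆ q⊆p))
q⊆p⇒q∪[p─q]≡p (outside ∷ p) (inside  ∷ q) q⊆p = contradiction (q⊆p here) λ ()

q⊆p⇒∣p∣≡∣q∣+∣p─q∣ : ∀ (p q : Subset n) → q ⊆ p → ∣ p ∣ ≡ ∣ q ∣ + ∣ p ─ q ∣
q⊆p⇒∣p∣≡∣q∣+∣p─q∣ []            []            _   = refl
q⊆p⇒∣p∣≡∣q∣+∣p─q∣ (outside ∷ p) (outside ∷ q) q⊆p = q⊆p⇒∣p∣≡∣q∣+∣p─q∣ p q (drop-∷-⊆ q⊆p)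
q⊆p⇒∣p∣≡∣q∣+∣p─q∣ (inside  ∷ p) (outside ∷ q) q⊆p =
  trans (cong suc (q⊆p⇒∣p∣≡∣q∣+∣p─q∣ p q (drop-∷-⊆ q⊆p))) (sym (+-suc ∣ q ∣ ∣ p ─ q ∣))
q⊆p⇒∣p∣≡∣q∣+∣p─q∣ (inside  ∷ p) (inside  ∷ q) q⊆p = cong suc (q⊆p⇒∣p∣≡∣q∣+∣p─q∣ p q (drop-∷-⊆ q⊆p))
q⊆p⇒∣p∣≡∣q∣+∣p─q∣ (outside ∷ p) (inside  ∷ q) q⊆p = contradiction (q⊆p here) λ ()

─-injectiveˡ : ∀ {p₁ p₂ q : Subset n} → q ⊆ p₁ → q ⊆ p₂ → p₁ ─ q ≡ p₂ ─ q → p₁ ≡ p₂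
─-injectiveˡ {p₁ = p₁} {p₂} {q} q⊆p₁ q⊆p₂ eq = begin
  p₁             ≡⟨ q⊆p⇒q∪[p─q]≡p p₁ q q⊆p₁ ⟨
  q ∪ (p₁ ─ q)   ≡⟨ cong (q ∪_) eq ⟩
  q ∪ (p₂ ─ q)   ≡⟨ q⊆p⇒q∪[p─q]≡p p₂ q q⊆p₂ ⟩
  p₂             ∎
  where open ≡-Reasoning

subsetsOfSize : Subset n → ℕ → List (Subset n)
subsetsOfSize []            zero    = [] ∷ₗ []ₗ
subsetsOfSize []            (suc k) = []ₗ
subsetsOfSize (outside ∷ p) k       = map (outside ∷_) (subsetsOfSize p k)
subsetsOfSize (inside  ∷ p) zero    = map (outside ∷_) (subsetsOfSize p zero)
subsetsOfSize (inside  ∷ p) (suc k) =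
  map (inside ∷_) (subsetsOfSize p k) ++ map (outside ∷_) (subsetsOfSize p (suc k))

∈-subsetsOfSize : ∀ {p q : Subset n} {k} → q ⊆ p → ∣ q ∣ ≡ k → q List.∈ subsetsOfSize p k
∈-subsetsOfSize {p = []}          {[]}          {zero}  _   _  = Any.here refl
∈-subsetsOfSize {p = outside ∷ p} {outside ∷ q}         q⊆p eq = ∈-map⁺ (outside ∷_) (∈-subsetsOfSize (drop-∷-⊆ q⊆p) eq)
∈-subsetsOfSize {p = outside ∷ p} {inside  ∷ q}         q⊆p _  = contradiction (q⊆p here) λ ()
∈-subsetsOfSize {p = inside  ∷ p} {outside ∷ q} {zero}  q⊆p eq = ∈-map⁺ (outside ∷_) (∈-subsetsOfSize (drop-∷-⊆ q⊆p) eq)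
∈-subsetsOfSize {p = inside  ∷ p} {outside ∷ q} {suc k} q⊆p eq =
  ∈-++⁺ʳ (map (inside ∷_) (subsetsOfSize p k)) (∈-map⁺ (outside ∷_) (∈-subsetsOfSize (drop-∷-⊆ q⊆p) eq))
∈-subsetsOfSize {p = inside  ∷ p} {inside  ∷ q} {suc k} q⊆p eq =
  ∈-++⁺ˡ (∈-map⁺ (inside ∷_) (∈-subsetsOfSize (drop-∷-⊆ q⊆p) (cong pred eq)))

-- The left-hand side unfolds to (1 + m) * m ^ k.
m^k+m^[1+k]≤[1+m]^[1+k] : ∀ m k → m ^ k + m ^ suc k ≤ suc m ^ suc k
m^k+m^[1+k]≤[1+m]^[1+k] m k = *-monoʳ-≤ (suc m) (^-monoˡ-≤ k (n≤1+n m))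

length-subsetsOfSize : ∀ (p : Subset n) k → length (subsetsOfSize p k) ≤ ∣ p ∣ ^ k
length-subsetsOfSize []            zero    = s≤s z≤n
length-subsetsOfSize []            (suc k) = z≤n
length-subsetsOfSize (outside ∷ p) k       =
  subst (_≤ ∣ p ∣ ^ k) (sym (length-map (outside ∷_) (subsetsOfSize p k))) (length-subsetsOfSize p k)
length-subsetsOfSize (inside  ∷ p) zero    =
  subst (_≤ 1) (sym (length-map (outside ∷_) (subsetsOfSize p zero))) (length-subsetsOfSize p zero)
length-subsetsOfSize (inside  ∷ p) (suc k) = begin
  length (map (inside ∷_) (subsetsOfSize p k) ++ map (outside ∷_) (subsetsOfSize p (suc k)))
    ≡⟨ length-++ (map (inside ∷_) (subsetsOfSize p k)) ⟩
  length (map (inside ∷_) (subsetsOfSize p k)) + length (map (outside ∷_) (subsetsOfSize p (suc k)))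
    ≡⟨ cong₂ _+_ (length-map (inside ∷_) (subsetsOfSize p k)) (length-map (outside ∷_) (subsetsOfSize p (suc k))) ⟩
  length (subsetsOfSize p k) + length (subsetsOfSize p (suc k))
    ≤⟨ +-mono-≤ (length-subsetsOfSize p k) (length-subsetsOfSize p (suc k)) ⟩
  ∣ p ∣ ^ k + ∣ p ∣ ^ suc k
    ≤⟨ m^k+m^[1+k]≤[1+m]^[1+k] ∣ p ∣ k ⟩
  suc ∣ p ∣ ^ suc k ∎
  where open ≤-Reasoning

injective-⊆-list⇒≤ : ∀ {A : Set} {ℓ} (f : Fin ℓ → A) (xs : List A) →
  Injective _≡_ _≡_ f → (∀ i → f i List.∈ xs) → ℓ ≤ length xs
injective-⊆-list⇒≤ f xs f-inj f∈xs = injective⇒≤ {f = λ i → Any.index (f∈xs i)} index-inj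
  where
  index-inj : Injective _≡_ _≡_ (λ i → Any.index (f∈xs i))
  index-inj {i} {j} eq = f-inj (begin
    f i                             ≡⟨ lookup-index (f∈xs i) ⟩
    lookup xs (Any.index (f∈xs i))  ≡⟨ cong (lookup xs) eq ⟩
    lookup xs (Any.index (f∈xs j))  ≡⟨ lookup-index (f∈xs j) ⟨
    f j                             ∎)
    where open ≡-Reasoning

distinct-subsetsOfSize-≤ : ∀ {ℓ k} (p : Subset n) (f : Fin ℓ → Subset n) → Injective _≡_ _≡_ f →
  (∀ i → f i ⊆ p) → (∀ i → ∣ f i ∣ ≡ k) → ℓ ≤ ∣ p ∣ ^ k
distinct-subsetsOfSize-≤ {k = k} p f f-inj f⊆p ∣f∣≡k =
  ≤-trans (injective-⊆-list⇒≤ f (subsetsOfSize p k) f-inj (λ i → ∈-subsetsOfSize (f⊆p i) (∣f∣≡k i)))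
          (length-subsetsOfSize p k)

module _ (G : Graph n) (S : Subset n) where

  IsCommonNbr⇒∈CommonNbhd : ∀ {v} → IsCommonNbr G S v → v ∈ CommonNbhd G S
  IsCommonNbr⇒∈CommonNbhd {v} v-nbr =
    lookup⇒[]= v (CommonNbhd G S) (trans (lookup∘tabulate _ v) (dec-true (isCommonNbr? G S v) v-nbr))

  clique─⊆CommonNbhd : ∀ {K} → IsClique G K → S ⊆ K → K ─ S ⊆ CommonNbhd G S
  clique─⊆CommonNbhd {K} K-clique S⊆K v∈K─S = IsCommonNbr⇒∈CommonNbhd λ s s∈S →
    K-clique (S⊆K s∈S) (p─q⊆p K S v∈K─S) λ { refl → x∈p─q⇒x∉q K S v∈K─S s∈S }

lemma2p1 : ∀ {n : ℕ} (G : Graph n) (S : Subset n) (ℓ r : ℕ) →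
    ∣ S ∣ < r →
    AtLeastCliquesContaining G ℓ r S →
    ℓ ≤ ∣ CommonNbhd G S ∣ ^ (r ∸ ∣ S ∣)
lemma2p1 G S ℓ r _ (K , K-inj , K-clique) =
  distinct-subsetsOfSize-≤ (CommonNbhd G S) (λ i → K i ─ S) K─S-injective
    (λ i → clique─⊆CommonNbhd G S (clique i) (S⊆K i)) ∣K─S∣≡r∸∣S∣
  where
  clique : ∀ i → IsClique G (K i)
  clique i = proj₁ (K-clique i)

  ∣K∣≡r : ∀ i → ∣ K i ∣ ≡ r
  ∣K∣≡r i = proj₁ (proj₂ (K-clique i))

  S⊆K : ∀ i → S ⊆ K i
  S⊆K i = proj₂ (proj₂ (K-clique i))

  K─S-injective : Injective _≡_ _≡_ (λ i → K i ─ S)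
  K─S-injective {i} {j} eq = K-inj (─-injectiveˡ (S⊆K i) (S⊆K j) eq)

  ∣K─S∣≡r∸∣S∣ : ∀ i → ∣ K i ─ S ∣ ≡ r ∸ ∣ S ∣
  ∣K─S∣≡r∸∣S∣ i = begin
    ∣ K i ─ S ∣                  ≡⟨ m+n∸m≡n ∣ S ∣ ∣ K i ─ S ∣ ⟨
    ∣ S ∣ + ∣ K i ─ S ∣ ∸ ∣ S ∣  ≡⟨ cong (_∸ ∣ S ∣) (q⊆p⇒∣p∣≡∣q∣+∣p─q∣ (K i) S (S⊆K i)) ⟨
    ∣ K i ∣ ∸ ∣ S ∣              ≡⟨ cong (_∸ ∣ S ∣) (∣K∣≡r i) ⟩
    r ∸ ∣ S ∣                    ∎
    where open ≡-Reasoning
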